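{- Let $r\ge 1$ be an integer and let $\prec$ be a total order on a finite set $V$. Let $F$ be a set of $r^3$ pairwise disjoint pairs $\{s,t\}$ of elements of $V$. Then there exist $r$ pairs in $F$ that form an $r$-rainbow, or an $r$-twist, or an $r$-necklace with respect to $\prec$.
   Context: For $k\ge2$ pairwise disjoint pairs $\langle s_i,t_i\rangle$, $i=1,\dots,k$, of elements of $V$, labeled so that $s_i\prec t_i$ for all $i$: they form a $k$-rainbow if, after relabeling the pairs, $s_1\prec\cdots\prec s_k\prec t_k\prec\cdots\prec t_1$; they form a $k$-necklace if, after relabeling, $s_1\prec t_1\prec s_2\prec t_2\prec\cdots\prec s_k\prec t_k$; they form a $k$-twist if, after relabeling, $s_1\prec\cdots\prec s_k\prec t_1\prec\cdots\prec t_k$. (For $r=1$ any single pair trivially qualifies.) -}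

module Defs where

open import Data.Nat using (ℕ)
open import Data.Fin using (Fin) renaming (_<_ to _<ᶠ_)
open import Data.Product using (_×_; proj₁; proj₂; Σ-syntax)
open import Data.Sum using (_⊎_)
open import Function.Definitions using (Injective)
open import Relation.Binary.PropositionalEquality using (_≡_)
open import Level using (0ℓ)
open import Relation.Binary.Core using (Rel)

-- A family of k pairs ⟨s i , t i⟩ (indexed by Fin k) in a set V with strict order ≺.
-- The index order of Fin k is the "relabeling"; conditions below are the
-- chains of the definitions written out pairwise.

module _ {V : Set} (_≺_ : Rel V 0ℓ) where

  -- s 1 ≺ ⋯ ≺ s k ≺ t k ≺ ⋯ ≺ t 1
  IsRainbow : {k : ℕ} → (Fin k → V × V) → Set
  IsRainbow p =
    (∀ i → proj₁ (p i) ≺ proj₂ (p i)) ×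
    (∀ i j → i <ᶠ j → (proj₁ (p i) ≺ proj₁ (p j)) × (proj₂ (p j) ≺ proj₂ (p i)))

  -- s 1 ≺ t 1 ≺ s 2 ≺ t 2 ≺ ⋯ ≺ s k ≺ t k
  IsNecklace : {k : ℕ} → (Fin k → V × V) → Set
  IsNecklace p =
    (∀ i → proj₁ (p i) ≺ proj₂ (p i)) ×
    (∀ i j → i <ᶠ j → proj₂ (p i) ≺ proj₁ (p j))

  -- s 1 ≺ ⋯ ≺ s k ≺ t 1 ≺ ⋯ ≺ t k
  IsTwist : {k : ℕ} → (Fin k → V × V) → Set
  IsTwist p =
    (∀ i j → proj₁ (p i) ≺ proj₂ (p j)) ×
    (∀ i j → i <ᶠ j → (proj₁ (p i) ≺ proj₁ (p j)) × (proj₂ (p i) ≺ proj₂ (p j)))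

Endpoint : {m : ℕ} {V : Set} → (Fin m → V × V) → (Fin m ⊎ Fin m) → V
Endpoint p (Data.Sum.inj₁ i) = proj₁ (p i)
Endpoint p (Data.Sum.inj₂ i) = proj₂ (p i)

-- the 2m endpoints are all distinct: pairs are pairwise disjoint and each pair has two elements
PairwiseDisjointPairs : {m : ℕ} {V : Set} → (Fin m → V × V) → Set
PairwiseDisjointPairs p = Injective _≡_ _≡_ (Endpoint p)

{-# OPTIONS --safe #-}

-- Two disjoint pairs i, j are related in exactly one of three ways: i lies entirely before j
-- (t i ≺ s j), i and j cross, or one is nested in the other. The relations "i lies before j",
-- "s i ≺ s j and t i ≺ t j" and "s i ≺ s j and t j ≺ t i" are strict partial orders whose
-- chains are necklaces, twists and rainbows respectively. By the dual of Dilworth's theorem,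
-- k·l·n pairs contain a necklace of length k or l·n pairs that pairwise overlap; among those,
-- a twist of length l or n pairs that pairwise do not cross, which are then pairwise nested
-- and, sorted, form a rainbow of length n.

module Submission where

open import Defs
open import Level using (Level; 0ℓ)
open import Function using (_∘_)
open import Function.Definitions using (Injective)
open import Data.Empty using (⊥-elim)
open import Data.Product using (_×_; _,_; proj₁; proj₂; Σ-syntax; ∃-syntax)
open import Data.Sum using (_⊎_; inj₁; inj₂)
open import Data.Sum.Properties using (inj₁-injective; inj₂-injective)
open import Data.Nat using (ℕ; zero; suc; _+_; _*_; _≤_; _^_; _≤?_; z≤n; s≤s)
open import Data.Nat.Properties
  using (+-cancelˡ-≤; +-monoˡ-≤; +-suc; ≤-trans; ≤-reflexive; ≰⇒≥; m≤n⇒m⊓n≡m; *-identityʳ; module ≤-Reasoning)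
open import Data.Fin using (Fin; zero; suc) renaming (_<_ to _<ᶠ_)
open import Data.Fin.Properties using (<-cmp)
open import Data.List using (List; []; _∷_; length; filter; take; lookup; allFin)
open import Data.List.Properties using (length-take; length-tabulate)
open import Data.List.Relation.Unary.All as All using (All; []; _∷_)
import Data.List.Relation.Unary.All.Properties as Allₚ
open import Data.List.Relation.Unary.Any using (Any; here; there; any?)
open import Data.List.Relation.Unary.AllPairs as AllPairs using (AllPairs; []; _∷_)
import Data.List.Relation.Unary.AllPairs.Properties as AllPairsₚ
open import Data.List.Relation.Unary.Unique.Propositional using (Unique)
open import Data.List.Relation.Unary.Unique.Propositional.Properties using (allFin⁺)
open import Data.List.Membership.Propositional using (_∈_; find; lose)
open import Data.List.Membership.Propositional.Properties using (∈-lookup; ∈-filter⁻; ∈-AllPairs₂)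
open import Data.List.Relation.Binary.Permutation.Propositional
  using (_↭_; ↭-refl; ↭-prep; ↭-swap; ↭-trans; ↭-sym)
open import Data.List.Relation.Binary.Permutation.Propositional.Properties using (All-resp-↭; ↭-length)
open import Relation.Binary.Core using (Rel)
open import Relation.Binary.Definitions using (Irreflexive; Transitive; Decidable; tri<; tri≈; tri>)
open import Relation.Binary.Structures using (IsStrictTotalOrder)
open import Relation.Binary.PropositionalEquality using (_≡_; _≢_; refl; sym; trans; cong; subst)
open import Relation.Nullary using (¬_; yes; no; ¬?)
open import Relation.Nullary.Decidable using (decidable-stable; _×-dec_)
import Relation.Unary as U
open import Relation.Unary.Properties using (∁?)

private
  variable
    a ℓ : Level
    A : Set a

Comparable : Rel A ℓ → Rel A ℓ
Comparable R x y = R x y ⊎ R y x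

Incomparable : Rel A ℓ → Rel A _
Incomparable R x y = x ≢ y × ¬ R x y × ¬ R y x

Family : Rel A ℓ → ℕ → List A → Set _
Family R k L = Σ[ xs ∈ List _ ] (length xs ≡ k × AllPairs R xs × All (_∈ L) xs)

module _ {R : Rel A ℓ} where

  AllPairs-lookup : ∀ {xs} → AllPairs R xs → ∀ i j → i <ᶠ j → R (lookup xs i) (lookup xs j)
  AllPairs-lookup (Rx ∷ _)   zero    (suc j) _         = All.lookup Rx (∈-lookup j)
  AllPairs-lookup (_ ∷ Rxs) (suc i) (suc j) (s≤s i<j) = AllPairs-lookup Rxs i j i<j

  lookup-injective : Irreflexive _≡_ R → ∀ {xs} → AllPairs R xs → Injective _≡_ _≡_ (lookup xs)
  lookup-injective irrefl Rxs {i} {j} eq with <-cmp i j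
  ... | tri< i<j _ _ = ⊥-elim (irrefl eq (AllPairs-lookup Rxs i j i<j))
  ... | tri≈ _ i≡j _ = i≡j
  ... | tri> _ _ j<i = ⊥-elim (irrefl (sym eq) (AllPairs-lookup Rxs j i j<i))

  lookup-chain : Irreflexive _≡_ R → ∀ {k xs} → AllPairs R xs → length xs ≡ k →
    Σ[ g ∈ (Fin k → A) ]
      (Injective _≡_ _≡_ g × (∀ i j → i <ᶠ j → R (g i) (g j)) × (∀ i → g i ∈ xs))
  lookup-chain irrefl {xs = xs} Rxs refl =
    lookup xs , lookup-injective irrefl Rxs , AllPairs-lookup Rxs , ∈-lookup

  AllPairs-map-∈ : ∀ {s} {S : Rel A s} {xs} →
    (∀ {x y} → x ∈ xs → y ∈ xs → R x y → S x y) → AllPairs R xs → AllPairs S xs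
  AllPairs-map-∈ f []         = []
  AllPairs-map-∈ f (Rx ∷ Rxs) =
    All.tabulate (λ y∈ → f (here refl) (there y∈) (All.lookup Rx y∈)) ∷
    AllPairs-map-∈ (λ x∈ y∈ → f (there x∈) (there y∈)) Rxs

  antichain-∈ : Irreflexive _≡_ R → ∀ {xs x y} →
    AllPairs (Incomparable R) xs → x ∈ xs → y ∈ xs → ¬ R x y
  antichain-∈ irrefl xs-antichain x∈ y∈ with ∈-AllPairs₂ xs-antichain x∈ y∈
  ... | inj₁ x≡y                   = irrefl x≡y
  ... | inj₂ (inj₁ (_ , ¬Rxy , _)) = ¬Rxy
  ... | inj₂ (inj₂ (_ , _ , ¬Rxy)) = ¬Rxy

  family-prefix : ∀ {k L xs} → k ≤ length xs → AllPairs R xs → All (_∈ L) xs → Family R k L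
  family-prefix {k} {xs = xs} k≤xs Rxs xs⊆L =
    take k xs , trans (length-take k xs) (m≤n⇒m⊓n≡m k≤xs) ,
    AllPairsₚ.take⁺ k Rxs , Allₚ.take⁺ k xs⊆L

  family-mono : ∀ {k L L′} → (∀ {x} → x ∈ L′ → x ∈ L) → Family R k L′ → Family R k L
  family-mono L′⊆L (xs , |xs| , Rxs , xs⊆L′) = xs , |xs| , Rxs , All.map L′⊆L xs⊆L′

length-filter-∁ : ∀ {p} {P : U.Pred A p} (P? : U.Decidable P) xs →
  length (filter P? xs) + length (filter (∁? P?) xs) ≡ length xs
length-filter-∁ P? []       = refl
length-filter-∁ P? (x ∷ xs) with P? x
... | yes _ = cong suc (length-filter-∁ P? xs)
... | no  _ = trans (+-suc _ _) (cong suc (length-filter-∁ P? xs))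

module _ {R : Rel A ℓ} (R-trans : Transitive R) where

  insert-into-chain : ∀ x {ys} → All (Comparable R x) ys → AllPairs R ys →
    ∃[ zs ] (zs ↭ x ∷ ys × AllPairs R zs)
  insert-into-chain x []                       []         = x ∷ [] , ↭-refl , [] ∷ []
  insert-into-chain x {y ∷ ys} (inj₁ Rxy ∷ _)  (Ry ∷ Rys) =
    x ∷ y ∷ ys , ↭-refl , (Rxy ∷ All.map (R-trans Rxy) Ry) ∷ Ry ∷ Rys
  insert-into-chain x {y ∷ ys} (inj₂ Ryx ∷ cs) (Ry ∷ Rys) =
    let zs , zs↭ , Rzs = insert-into-chain x cs Rys
    in y ∷ zs , ↭-trans (↭-prep y zs↭) (↭-swap y x ↭-refl) ,
       All-resp-↭ (↭-sym zs↭) (Ryx ∷ Ry) ∷ Rzs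

  sort-comparable : ∀ {xs} → AllPairs (Comparable R) xs → ∃[ zs ] (zs ↭ xs × AllPairs R zs)
  sort-comparable []         = [] , ↭-refl , []
  sort-comparable {x ∷ _} (cx ∷ cs) =
    let zs , zs↭ , Rzs = sort-comparable cs
        ws , ws↭ , Rws = insert-into-chain x (All-resp-↭ (↭-sym zs↭) cx) Rzs
    in ws , ↭-trans ws↭ (↭-prep x zs↭) , Rws

-- The dual of Dilworth's theorem: either the minimal elements form an antichain of size l,
-- or fewer than l elements are removed and a chain of the rest extends downwards.
module ChainOrAntichain {_<_ : Rel A ℓ} (<-trans : Transitive _<_) (_<?_ : Decidable _<_) where

  Minimal : List A → A → Set _
  Minimal L x = ¬ Any (_< x) L

  minimal? : ∀ L → U.Decidable (Minimal L)
  minimal? L x = ¬? (any? (_<? x) L)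

  minimals nonminimals : List A → List A
  minimals    L = filter (minimal? L) L
  nonminimals L = filter (∁? (minimal? L)) L

  ∈-minimals⁻ : ∀ {L x} → x ∈ minimals L → x ∈ L × Minimal L x
  ∈-minimals⁻ {L} = ∈-filter⁻ (minimal? L) {xs = L}

  ∈-nonminimals⁻ : ∀ {L x} → x ∈ nonminimals L → x ∈ L × ¬ Minimal L x
  ∈-nonminimals⁻ {L} = ∈-filter⁻ (∁? (minimal? L)) {xs = L}

  below-nonminimal : ∀ {L x} → ¬ Minimal L x → ∃[ y ] (y ∈ L × y < x)
  below-nonminimal {L} {x} = find ∘ decidable-stable (any? (_<? x) L)

  minimals-antichain : ∀ {L} → Unique L → AllPairs (Incomparable _<_) (minimals L)
  minimals-antichain {L} L-unique =
    AllPairs-map-∈ (λ x∈ y∈ x≢y → x≢y , not-below y∈ x∈ , not-below x∈ y∈)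
                   (AllPairsₚ.filter⁺ (minimal? L) L-unique)
    where
    not-below : ∀ {x y} → y ∈ minimals L → x ∈ minimals L → ¬ x < y
    not-below y∈ x∈ x<y =
      proj₂ (∈-minimals⁻ {L} y∈) (lose (proj₁ (∈-minimals⁻ {L} x∈)) x<y)

  extend-chain : ∀ {k} L → 1 ≤ length L → Family _<_ k (nonminimals L) → Family _<_ (suc k) L
  extend-chain (x ∷ _) _ ([] , refl , [] , []) = x ∷ [] , refl , [] ∷ [] , here refl ∷ []
  extend-chain L _ (c ∷ cs , |cs| , (c<cs ∷ cs-chain) , (c∈ ∷ cs∈))
    with below-nonminimal (proj₂ (∈-nonminimals⁻ c∈))
  ... | z , z∈L , z<c =
    z ∷ c ∷ cs , cong suc |cs| , (z<c ∷ All.map (<-trans z<c) c<cs) ∷ c<cs ∷ cs-chain ,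
    z∈L ∷ All.map (proj₁ ∘ ∈-nonminimals⁻) (c∈ ∷ cs∈)

  chain-or-antichain : ∀ k l L → Unique L → k * l ≤ length L →
    Family _<_ k L ⊎ Family (Incomparable _<_) l L
  chain-or-antichain zero    l       L _        _     = inj₁ ([] , refl , [] , [])
  chain-or-antichain (suc k) zero    L _        _     = inj₂ ([] , refl , [] , [])
  chain-or-antichain (suc k) (suc l) L L-unique kl≤L with suc l ≤? length (minimals L)
  ... | yes l≤M = inj₂ (family-prefix l≤M (minimals-antichain L-unique)
                                      (All.tabulate (proj₁ ∘ ∈-minimals⁻ {L})))
  ... | no  l≰M with chain-or-antichain k (suc l) (nonminimals L)
                       (AllPairsₚ.filter⁺ (∁? (minimal? L)) L-unique) kl≤N
    where
    open ≤-Reasoning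
    kl≤N : k * suc l ≤ length (nonminimals L)
    kl≤N = +-cancelˡ-≤ (suc l) _ _ (begin
      suc l + k * suc l                              ≤⟨ kl≤L ⟩
      length L                                       ≡⟨ sym (length-filter-∁ (minimal? L) L) ⟩
      length (minimals L) + length (nonminimals L)   ≤⟨ +-monoˡ-≤ _ (≰⇒≥ l≰M) ⟩
      suc l + length (nonminimals L)                 ∎)
  ...   | inj₁ chain     = inj₁ (extend-chain L (≤-trans (s≤s z≤n) kl≤L) chain)
  ...   | inj₂ antichain = inj₂ (family-mono (proj₁ ∘ ∈-nonminimals⁻) antichain)

module PairFamily {V : Set} {_≺_ : Rel V 0ℓ} (≺-isSTO : IsStrictTotalOrder _≡_ _≺_)
  {m : ℕ} (F : Fin m → V × V) (s≺t : ∀ i → proj₁ (F i) ≺ proj₂ (F i))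
  (disjoint : PairwiseDisjointPairs F) where

  open IsStrictTotalOrder ≺-isSTO using (compare; irrefl; asym; _<?_) renaming (trans to ≺-trans)

  s t : Fin m → V
  s = proj₁ ∘ F
  t = proj₂ ∘ F

  s-injective : Injective _≡_ _≡_ s
  s-injective eq = inj₁-injective (disjoint {inj₁ _} {inj₁ _} eq)

  t-injective : Injective _≡_ _≡_ t
  t-injective eq = inj₂-injective (disjoint {inj₂ _} {inj₂ _} eq)

  s≢t : ∀ i j → s i ≢ t j
  s≢t i j eq with disjoint {inj₁ i} {inj₂ j} eq
  ... | ()

  NecklaceOrder TwistOrder RainbowOrder : Rel (Fin m) 0ℓ
  NecklaceOrder i j = t i ≺ s j
  TwistOrder    i j = s i ≺ s j × t i ≺ t j
  RainbowOrder  i j = s i ≺ s j × t j ≺ t i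

  necklace-trans : Transitive NecklaceOrder
  necklace-trans {j = j} ti≺sj tj≺sk = ≺-trans (≺-trans ti≺sj (s≺t j)) tj≺sk

  twist-trans : Transitive TwistOrder
  twist-trans (si≺sj , ti≺tj) (sj≺sk , tj≺tk) = ≺-trans si≺sj sj≺sk , ≺-trans ti≺tj tj≺tk

  rainbow-trans : Transitive RainbowOrder
  rainbow-trans (si≺sj , tj≺ti) (sj≺sk , tk≺tj) = ≺-trans si≺sj sj≺sk , ≺-trans tk≺tj tj≺ti

  necklace-irrefl : Irreflexive _≡_ NecklaceOrder
  necklace-irrefl {i} refl = asym (s≺t i)

  twist-irrefl : Irreflexive _≡_ TwistOrder
  twist-irrefl refl = irrefl refl ∘ proj₁

  rainbow-irrefl : Irreflexive _≡_ RainbowOrder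
  rainbow-irrefl refl = irrefl refl ∘ proj₁

  s≺t-unless-precedes : ∀ {i j} → ¬ NecklaceOrder j i → s i ≺ t j
  s≺t-unless-precedes {i} {j} ¬tj≺si with compare (s i) (t j)
  ... | tri< si≺tj _ _ = si≺tj
  ... | tri≈ _ si≡tj _ = ⊥-elim (s≢t i j si≡tj)
  ... | tri> _ _ tj≺si = ⊥-elim (¬tj≺si tj≺si)

  twist-incomparable⇒rainbow-comparable : ∀ {i j} →
    Incomparable TwistOrder i j → Comparable RainbowOrder i j
  twist-incomparable⇒rainbow-comparable {i} {j} (i≢j , ¬i<j , ¬j<i)
    with compare (s i) (s j) | compare (t i) (t j)
  ... | tri≈ _ si≡sj _ | _              = ⊥-elim (i≢j (s-injective si≡sj))
  ... | _              | tri≈ _ ti≡tj _ = ⊥-elim (i≢j (t-injective ti≡tj))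
  ... | tri< si≺sj _ _ | tri< ti≺tj _ _ = ⊥-elim (¬i<j (si≺sj , ti≺tj))
  ... | tri< si≺sj _ _ | tri> _ _ tj≺ti = inj₁ (si≺sj , tj≺ti)
  ... | tri> _ _ sj≺si | tri< ti≺tj _ _ = inj₂ (sj≺si , ti≺tj)
  ... | tri> _ _ sj≺si | tri> _ _ tj≺ti = ⊥-elim (¬j<i (sj≺si , tj≺ti))

  Selection : (k : ℕ) → ((Fin k → V × V) → Set) → Set
  Selection k P = Σ[ g ∈ (Fin k → Fin m) ] (Injective _≡_ _≡_ g × P (F ∘ g))

  necklace-selection : ∀ {k L} → Family NecklaceOrder k L → Selection k (IsNecklace _≺_)
  necklace-selection (xs , |xs| , chain , _) =
    let g , g-injective , g-chain , _ = lookup-chain necklace-irrefl chain |xs|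
    in g , g-injective , s≺t ∘ g , g-chain

  twist-selection : ∀ {k L} → AllPairs (Incomparable NecklaceOrder) L →
    Family TwistOrder k L → Selection k (IsTwist _≺_)
  twist-selection L-antichain (xs , |xs| , chain , xs⊆L) =
    let g , g-injective , g-chain , g∈xs = lookup-chain twist-irrefl chain |xs|
        g∈L = All.lookup xs⊆L ∘ g∈xs
    in g , g-injective ,
       (λ i j → s≺t-unless-precedes (antichain-∈ necklace-irrefl L-antichain (g∈L j) (g∈L i))) ,
       g-chain

  rainbow-selection : ∀ {k L} → Family (Incomparable TwistOrder) k L → Selection k (IsRainbow _≺_)
  rainbow-selection (xs , |xs| , antichain , _) =
    let zs , zs↭xs , chain = sort-comparable rainbow-trans
                               (AllPairs.map twist-incomparable⇒rainbow-comparable antichain)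
        g , g-injective , g-chain , _ = lookup-chain rainbow-irrefl chain (trans (↭-length zs↭xs) |xs|)
    in g , g-injective , s≺t ∘ g , g-chain

  module Necklaces = ChainOrAntichain necklace-trans (λ i j → t i <? s j)
  module Twists    = ChainOrAntichain twist-trans (λ i j → (s i <? s j) ×-dec (t i <? t j))

  rainbow-twist-or-necklace : ∀ k l n → k * (l * n) ≤ m →
    Selection n (IsRainbow _≺_) ⊎ Selection l (IsTwist _≺_) ⊎ Selection k (IsNecklace _≺_)
  rainbow-twist-or-necklace k l n kln≤m
    with Necklaces.chain-or-antichain k (l * n) (allFin m) (allFin⁺ m)
           (subst (k * (l * n) ≤_) (sym (length-tabulate (λ i → i))) kln≤m)
  ... | inj₁ necklace = inj₂ (inj₂ (necklace-selection necklace))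
  ... | inj₂ (L , |L| , L-antichain , _)
    with Twists.chain-or-antichain l n L (AllPairs.map proj₁ L-antichain) (≤-reflexive (sym |L|))
  ...   | inj₁ twist   = inj₂ (inj₁ (twist-selection L-antichain twist))
  ...   | inj₂ rainbow = inj₁ (rainbow-selection rainbow)

corollary2 : (r n : ℕ) → 1 ≤ r →
    (_≺_ : Rel (Fin n) 0ℓ) → IsStrictTotalOrder _≡_ _≺_ →
    (F : Fin (r ^ 3) → Fin n × Fin n) →
    (∀ i → proj₁ (F i) ≺ proj₂ (F i)) →
    PairwiseDisjointPairs F →
    Σ[ g ∈ (Fin r → Fin (r ^ 3)) ] (Injective _≡_ _≡_ g ×
    (IsRainbow _≺_ (F ∘ g) ⊎ IsTwist _≺_ (F ∘ g) ⊎ IsNecklace _≺_ (F ∘ g)))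
-- The case r = 0 is trivial, so 1 ≤ r is not needed.
corollary2 r n _ _≺_ ≺-isSTO F s≺t disjoint
  with PairFamily.rainbow-twist-or-necklace ≺-isSTO F s≺t disjoint r r r
         (≤-reflexive (cong (λ x → r * (r * x)) (sym (*-identityʳ r))))
... | inj₁ (g , g-injective , rainbow)         = g , g-injective , inj₁ rainbow
... | inj₂ (inj₁ (g , g-injective , twist))    = g , g-injective , inj₂ (inj₁ twist)
... | inj₂ (inj₂ (g , g-injective , necklace)) = g , g-injective , inj₂ (inj₂ necklace)
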